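{- Let $F$ be a finite field. The multiplicative group $F^{\times}$ is indecomposable if and only if $F$ is isomorphic to one of the following fields: (1) $\mathbf{F}_2$; (2) $\mathbf{F}_9$; (3) $\mathbf{F}_p$ where $p$ is a Fermat prime; (4) $\mathbf{F}_{q+1}$ where $q$ is a Mersenne prime.
   Context: $\mathbf{F}_m$ denotes the finite field with $m$ elements. A group is indecomposable if it cannot be written as a direct sum of two non-trivial subgroups (the trivial group counts as indecomposable). A Fermat prime is a prime of the form $2^{2^{k}}+1$ ($k \geq 0$); a Mersenne prime is a prime of the form $2^{r}-1$. -}

module Defs where

open import Level using (Level; _⊔_; suc)
open import Algebra.Bundles using (CommutativeRing)
open import Data.Nat using (ℕ; _+_; _∸_; _^_)
open import Data.Nat.Primality using (Prime)
open import Data.Fin using (Fin)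
open import Data.Product using (Σ; ∃; _×_; _,_; proj₁)
open import Data.Sum using (_⊎_)
open import Relation.Nullary using (¬_)
open import Relation.Unary using (Pred)
open import Relation.Binary.PropositionalEquality using (_≡_)
import Relation.Binary.PropositionalEquality as ≡
open import Function.Bundles using (Inverse)

record Field (c ℓ : Level) : Set (suc (c ⊔ ℓ)) where
  field
    commutativeRing : CommutativeRing c ℓ
  open CommutativeRing commutativeRing public
  field
    1≉0     : ¬ (1# ≈ 0#)
    inverse : ∀ x → ¬ (x ≈ 0#) → Σ Carrier λ y → (x * y) ≈ 1#

HasCard : ∀ {c ℓ} → Field c ℓ → ℕ → Set (c ⊔ ℓ)
HasCard F n = Inverse (≡.setoid (Fin n)) (Field.setoid F)

record FiniteField (c ℓ : Level) : Set (suc (c ⊔ ℓ)) where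
  field
    field′ : Field c ℓ
    card   : ℕ
    enum   : HasCard field′ card
  open Field field′ public

module Units {c ℓ} (F : Field c ℓ) where
  open Field F

  Unit : Set (c ⊔ ℓ)
  Unit = Σ Carrier λ x → ¬ (x ≈ 0#)

  _≈ᵘ_ : Unit → Unit → Set ℓ
  u ≈ᵘ v = proj₁ u ≈ proj₁ v

  record IsSubgroup (H : Pred Unit ℓ) : Set (c ⊔ ℓ) where
    field
      resp  : ∀ {u v} → u ≈ᵘ v → H u → H v
      has1  : ∀ (p : ¬ (1# ≈ 0#)) → H (1# , p)
      mul   : ∀ {u v} (p : ¬ ((proj₁ u * proj₁ v) ≈ 0#)) →
                H u → H v → H (proj₁ u * proj₁ v , p)
      inv   : ∀ {u v} → (proj₁ u * proj₁ v) ≈ 1# → H u → H v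

  Nontrivial : Pred Unit ℓ → Set (c ⊔ ℓ)
  Nontrivial H = Σ Unit λ u → H u × ¬ (proj₁ u ≈ 1#)

  IsDirectSum : Pred Unit ℓ → Pred Unit ℓ → Set (c ⊔ ℓ)
  IsDirectSum H K =
    (∀ u → H u → K u → proj₁ u ≈ 1#) ×
    (∀ (w : Unit) → Σ Unit λ u → Σ Unit λ v →
        H u × K v × (proj₁ w ≈ (proj₁ u * proj₁ v)))

  Indecomposable : Set (suc ℓ ⊔ c)
  Indecomposable =
    ¬ (Σ (Pred Unit ℓ) λ H → Σ (Pred Unit ℓ) λ K →
         IsSubgroup H × IsSubgroup K × Nontrivial H × Nontrivial K ×
         IsDirectSum H K)

FermatPrime : ℕ → Set
FermatPrime p = Prime p × ∃ λ k → p ≡ 2 ^ (2 ^ k) + 1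

MersennePrime : ℕ → Set
MersennePrime q = Prime q × ∃ λ r → q ≡ 2 ^ r ∸ 1

-- F ≅ 𝔽_m, i.e. F is a (finite) field with exactly m elements
-- (finite fields are determined up to isomorphism by their order).
IsoToFF : ∀ {c ℓ} → Field c ℓ → ℕ → Set (c ⊔ ℓ)
IsoToFF F m = HasCard F m

-- Every unit satisfies u ^ m = 1 for m = |F| − 1, and x ^ n = 1 has at most n roots in a field.
-- If m = a b with coprime a, b > 1, the groups μ_a and μ_b of roots of unity are nontrivial,
-- meet only in 1 and (by Bézout) generate F^×, so F^× is decomposable. If m = r ^ e with r
-- prime, every nontrivial subgroup contains an element of order r; if two of them, H and K, met
-- only in 1, the r powers of such an element of H together with such an element of K would be
-- r + 1 roots of x ^ r = 1. So F^× is indecomposable iff |F| − 1 is a prime power. As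
-- |F| = p ^ k (F is a vector space over its prime field), it remains to solve p ^ k = r ^ e + 1:
-- e = 0 gives F_2; r = 2 gives a Fermat prime (k = 1) or 9 (k ≥ 2); odd r forces p = 2 and
-- e = 1, a Mersenne prime r. These steps divide x ^ (2g + 1) + 1 by x + 1 and x ^ n − 1 by
-- x − 1: for odd x and odd exponent the cofactor is odd, so it divides a power of 2 only if it
-- is 1.

module Submission where

open import Defs

module Arithmetic where

  open import Data.List.Base using ([]; _∷_)
  open import Data.List.Relation.Unary.All using (_∷_)
  open import Data.Nat.Base
    using ( ℕ; zero; suc; _+_; _*_; _^_; _∸_; _<_; z<s; s<s; z≤n; s≤s; NonZero
          ; >-nonZero; ≢-nonZero; ≢-nonZero⁻¹; n>1⇒nonTrivial; nonTrivial⇒n>1 )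
  open import Data.Nat.Coprimality as Coprime using (Coprime; coprime-divisor)
  open import Data.Nat.Divisibility
  open import Data.Nat.Induction using (<-rec)
  open import Data.Nat.ListAction using (product)
  open import Data.Nat.Primality
  open import Data.Nat.Primality.Factorisation using (factorise)
  open import Data.Nat.Properties
  open import Data.Nat.Tactic.RingSolver using (solve-∀)
  open import Data.Product.Base using (∃; ∃₂; _×_; _,_; map₂)
  open import Data.Sum.Base as Sum using (_⊎_; inj₁; inj₂)
  open import Function.Base using (_∘_; case_of_)
  open import Relation.Binary.PropositionalEquality
  open import Relation.Nullary using (¬_; yes; no; contradiction)

  data Parity : ℕ → Set where
    even : ∀ k → Parity (2 * k)
    odd  : ∀ k → Parity (1 + 2 * k)

  parity : ∀ n → Parity n
  parity zero = even 0
  parity (suc n) with parity n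
  ... | even k = odd k
  ... | odd k  = subst Parity (cong suc (+-suc k (k + 0))) (even (suc k))

  2∤1 : ¬ 2 ∣ 1
  2∤1 2∣1 = contradiction (∣1⇒≡1 2∣1) λ ()

  2∤1+2k : ∀ k → ¬ 2 ∣ 1 + 2 * k
  2∤1+2k k 2∣1+2k = 2∤1 (∣m+n∣m⇒∣n (subst (2 ∣_) (+-comm 1 (2 * k)) 2∣1+2k) (m∣m*n k))

  2∤⇒≡1+2k : ∀ {n} → ¬ 2 ∣ n → ∃ λ k → n ≡ 1 + 2 * k
  2∤⇒≡1+2k {n} 2∤n with parity n
  ... | even k = contradiction (m∣m*n k) 2∤n
  ... | odd k  = k , refl

  2∤* : ∀ {m n} → ¬ 2 ∣ m → ¬ 2 ∣ n → ¬ 2 ∣ m * n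
  2∤* {m} {n} 2∤m 2∤n 2∣mn with euclidsLemma m n prime[2] 2∣mn
  ... | inj₁ 2∣m = 2∤m 2∣m
  ... | inj₂ 2∣n = 2∤n 2∣n

  2∤^ : ∀ {m} → ¬ 2 ∣ m → ∀ n → ¬ 2 ∣ m ^ n
  2∤^ 2∤m zero    = 2∤1
  2∤^ 2∤m (suc n) = 2∤* 2∤m (2∤^ 2∤m n)

  prime>1 : ∀ {p} → Prime p → 1 < p
  prime>1 p-prime = nonTrivial⇒n>1 _ {{prime⇒nonTrivial p-prime}}

  prime∣^⇒∣ : ∀ {p m} n → Prime p → p ∣ m ^ n → p ∣ m
  prime∣^⇒∣ zero    p-prime p∣1 = contradiction (∣1⇒≡1 p∣1) (>⇒≢ (prime>1 p-prime))
  prime∣^⇒∣ {m = m} (suc n) p-prime p∣mmⁿ with euclidsLemma m (m ^ n) p-prime p∣mmⁿ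
  ... | inj₁ p∣m  = p∣m
  ... | inj₂ p∣mⁿ = prime∣^⇒∣ n p-prime p∣mⁿ

  prime∧2∣⇒≡2 : ∀ {p} → Prime p → 2 ∣ p → p ≡ 2
  prime∧2∣⇒≡2 p-prime 2∣p with prime⇒irreducible p-prime 2∣p
  ... | inj₂ 2≡p = sym 2≡p

  prime⇒≡2⊎2∤ : ∀ {p} → Prime p → p ≡ 2 ⊎ ¬ 2 ∣ p
  prime⇒≡2⊎2∤ {p} p-prime with 2 ∣? p
  ... | yes 2∣p = inj₁ (prime∧2∣⇒≡2 p-prime 2∣p)
  ... | no  2∤p = inj₂ 2∤p

  ∤⇒coprime : ∀ {p n} → Prime p → ¬ p ∣ n → Coprime p n
  ∤⇒coprime p-prime p∤n (d∣p , d∣n) with prime⇒irreducible p-prime d∣p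
  ... | inj₁ d≡1  = d≡1
  ... | inj₂ refl = contradiction d∣n p∤n

  coprime-^ʳ : ∀ {a b} → Coprime a b → ∀ n → Coprime a (b ^ n)
  coprime-^ʳ coprime zero    (_ , d∣1)         = ∣1⇒≡1 d∣1
  coprime-^ʳ coprime (suc n) (d∣a , d∣b*bⁿ) =
    coprime-^ʳ coprime n
      (d∣a , coprime-divisor (λ (e∣d , e∣b) → coprime (∣-trans e∣d d∣a , e∣b)) d∣b*bⁿ)

  2∤∧∣2^⇒≡1 : ∀ {d} m → ¬ 2 ∣ d → d ∣ 2 ^ m → d ≡ 1
  2∤∧∣2^⇒≡1 zero    2∤d d∣1    = ∣1⇒≡1 d∣1
  2∤∧∣2^⇒≡1 (suc m) 2∤d d∣2*2ᵐ =
    2∤∧∣2^⇒≡1 m 2∤d (coprime-divisor (Coprime.sym (∤⇒coprime prime[2] 2∤d)) d∣2*2ᵐ)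

  ¬prime[m*n] : ∀ {m n} → 1 < m → 1 < n → ¬ Prime (m * n)
  ¬prime[m*n] {m} {n} 1<m 1<n mn-prime =
    prime⇒¬composite mn-prime (hasNonTrivialDivisor {{n>1⇒nonTrivial 1<m}}
      (m<m*n m n {{>-nonZero (<-trans z<s 1<m)}} 1<n) (m∣m*n n))

  prime-divisor : ∀ n → 1 < n → ∃ λ p → Prime p × p ∣ n
  prime-divisor n@(suc _) 1<n with factorise n
  ... | record { factors = [] ; isFactorisation = n≡1 } = contradiction n≡1 (>⇒≢ 1<n)
  ... | record { factors = p ∷ ps ; isFactorisation = n≡p*ps ; factorsPrime = p-prime ∷ _ } =
    p , p-prime , divides (product ps) (trans n≡p*ps (*-comm p (product ps)))

  split-power : ∀ {p} → 1 < p → ∀ n → .{{NonZero n}} → ∃₂ λ v b → ¬ p ∣ b × n ≡ p ^ v * b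
  split-power {p} 1<p = <-rec P step
    where
    P : ℕ → Set
    P n = .{{NonZero n}} → ∃₂ λ v b → ¬ p ∣ b × n ≡ p ^ v * b
    step : ∀ n → (∀ {m} → m < n → P m) → P n
    step n rec with p ∣? n
    ... | no  p∤n              = 0 , n , p∤n , sym (+-identityʳ n)
    ... | yes (divides q n≡qp) = extend (rec q<n {{q≢0}})
      where
      q≢0 : NonZero q
      q≢0 = ≢-nonZero λ { refl → ≢-nonZero⁻¹ n n≡qp }
      q<n : q < n
      q<n = subst (q <_) (sym n≡qp) (m<m*n q p {{q≢0}} 1<p)
      extend : ∃₂ (λ v b → ¬ p ∣ b × q ≡ p ^ v * b) → ∃₂ λ v b → ¬ p ∣ b × n ≡ p ^ v * b
      extend (v , b , p∤b , q≡pᵛb) = suc v , b , p∤b , (begin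
        n               ≡⟨ n≡qp ⟩
        q * p           ≡⟨ cong (_* p) q≡pᵛb ⟩
        p ^ v * b * p   ≡⟨ *-comm (p ^ v * b) p ⟩
        p * (p ^ v * b) ≡⟨ *-assoc p (p ^ v) b ⟨
        p * p ^ v * b   ∎)
        where open ≡-Reasoning

  IsPrimePower : ℕ → Set
  IsPrimePower n = ∃₂ λ r e → Prime r × n ≡ r ^ e

  CoprimeFactorisation : ℕ → Set
  CoprimeFactorisation n = ∃₂ λ a b → 1 < a × 1 < b × Coprime a b × a * b ≡ n

  primePower⊎coprimeFactorisation : ∀ n → .{{NonZero n}} → IsPrimePower n ⊎ CoprimeFactorisation n
  primePower⊎coprimeFactorisation 1 = inj₁ (2 , 0 , prime[2] , refl)
  primePower⊎coprimeFactorisation n@(suc (suc _))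
    with p , p-prime , p∣n ← prime-divisor n (s<s z<s)
    with v , b , p∤b , n≡pᵛb ← split-power (prime>1 p-prime) n
    = split v b p∤b n≡pᵛb
    where
    split : ∀ v b → ¬ p ∣ b → n ≡ p ^ v * b → IsPrimePower n ⊎ CoprimeFactorisation n
    split v       0               _   n≡pᵛ*0 = contradiction (trans n≡pᵛ*0 (*-zeroʳ (p ^ v))) λ ()
    split v       1               _   n≡pᵛ*1 = inj₁ (p , v , p-prime , trans n≡pᵛ*1 (*-identityʳ (p ^ v)))
    split 0       b@(suc (suc _)) p∤b n≡1*b  =
      contradiction (subst (p ∣_) (trans n≡1*b (+-identityʳ b)) p∣n) p∤b
    split (suc v) b@(suc (suc _)) p∤b n≡pᵛb =
      inj₂ (p ^ suc v , b , ^-monoʳ-< p (prime>1 p-prime) (z<s {n = v}) , s<s z<s ,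
            Coprime.sym (coprime-^ʳ (Coprime.sym (∤⇒coprime p-prime p∤b)) (suc v)) , sym n≡pᵛb)

  1<x⇒1<x^[1+n] : ∀ {x} n → 1 < x → 1 < x ^ suc n
  1<x⇒1<x^[1+n] {x} n 1<x = ^-monoʳ-< x 1<x (z<s {n = n})

  geomSum : ℕ → ℕ → ℕ
  geomSum x zero    = 0
  geomSum x (suc n) = 1 + x * geomSum x n

  geomSum-telescopes : ∀ s n → s * geomSum (1 + s) n + 1 ≡ (1 + s) ^ n
  geomSum-telescopes s zero    = cong (_+ 1) (*-zeroʳ s)
  geomSum-telescopes s (suc n) = begin
    s * (1 + (1 + s) * G) + 1 ≡⟨ regroup s G ⟩
    (1 + s) * (s * G + 1)     ≡⟨ cong ((1 + s) *_) (geomSum-telescopes s n) ⟩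
    (1 + s) * (1 + s) ^ n     ∎
    where
    open ≡-Reasoning
    G : ℕ
    G = geomSum (1 + s) n
    regroup : ∀ s G → s * (1 + (1 + s) * G) + 1 ≡ (1 + s) * (s * G + 1)
    regroup = solve-∀

  geomSum-odd : ∀ {x} → ¬ 2 ∣ x → ∀ g → ¬ 2 ∣ geomSum x (1 + 2 * g)
  geomSum-odd {x} 2∤x zero    = subst (¬_ ∘ (2 ∣_)) (cong suc (sym (*-zeroʳ x))) 2∤1
  geomSum-odd {x} 2∤x (suc g) 2∣G′ =
    geomSum-odd 2∤x g (2∣G (∣m+n∣m⇒∣n (subst (2 ∣_) unfold 2∣G′) 2∣1+x))
    where
    G : ℕ
    G = geomSum x (1 + 2 * g)
    unfold : geomSum x (1 + 2 * suc g) ≡ (1 + x) + x * x * G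
    unfold = trans (cong (geomSum x) (exponent g)) (regroup x G)
      where
      exponent : ∀ g → 1 + 2 * suc g ≡ 2 + (1 + 2 * g)
      exponent = solve-∀
      regroup : ∀ x G → 1 + x * (1 + x * G) ≡ (1 + x) + x * x * G
      regroup = solve-∀
    2∣1+x : 2 ∣ 1 + x
    2∣1+x with t , refl ← 2∤⇒≡1+2k 2∤x = divides (1 + t) (regroup t)
      where
      regroup : ∀ t → 1 + (1 + 2 * t) ≡ (1 + t) * 2
      regroup = solve-∀
    2∣G : 2 ∣ x * x * G → 2 ∣ G
    2∣G 2∣xxG with euclidsLemma (x * x) G prime[2] 2∣xxG
    ... | inj₁ 2∣xx = contradiction 2∣xx (2∤* 2∤x 2∤x)
    ... | inj₂ 2∣G  = 2∣G

  -- (x ^ (1 + 2g) + 1) / (x + 1) = x ^ 2g − x ^ (2g − 1) + ⋯ − x + 1,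
  -- grouped as 1 + (x − 1) (x + x ^ 3 + ⋯ + x ^ (2g − 1)) to stay within ℕ.
  altGeomSum : ℕ → ℕ → ℕ
  altGeomSum x g = 1 + (x ∸ 1) * (x * geomSum (x * x) g)

  altGeomSum-factorises : ∀ x g → .{{NonZero x}} → (1 + x) * altGeomSum x g ≡ x ^ (1 + 2 * g) + 1
  altGeomSum-factorises x@(suc s) g = begin
    (2 + s) * (1 + s * (x * G))   ≡⟨ regroup s G ⟩
    1 + x * (T * G + 1)           ≡⟨ cong (λ y → 1 + x * y) (geomSum-telescopes T g) ⟩
    1 + x * (x * x) ^ g           ≡⟨ cong (λ y → 1 + x * (x * y) ^ g) (*-identityʳ x) ⟨
    1 + x * (x ^ 2) ^ g           ≡⟨ cong (λ y → 1 + x * y) (^-*-assoc x 2 g) ⟩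
    1 + x ^ (1 + 2 * g)           ≡⟨ +-comm 1 _ ⟩
    x ^ (1 + 2 * g) + 1           ∎
    where
    open ≡-Reasoning
    T G : ℕ
    T = s + s * x
    G = geomSum (x * x) g
    regroup : ∀ s G → (2 + s) * (1 + s * ((1 + s) * G)) ≡ 1 + (1 + s) * ((s + s * (1 + s)) * G + 1)
    regroup = solve-∀

  altGeomSum-odd : ∀ {x} → ¬ 2 ∣ x → ∀ g → ¬ 2 ∣ altGeomSum x g
  altGeomSum-odd 2∤x g with t , refl ← 2∤⇒≡1+2k 2∤x =
    subst (¬_ ∘ (2 ∣_)) (cong suc (sym (*-assoc 2 t _))) (2∤1+2k (t * _))

  altGeomSum>1 : ∀ {x} g → 1 < x → 1 < altGeomSum x (suc g)
  altGeomSum>1 g (s≤s (s≤s _)) = s≤s (s≤s z≤n)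

  prime[2^e+1]⇒e≡2^j : ∀ e → .{{NonZero e}} → Prime (2 ^ e + 1) → ∃ λ j → e ≡ 2 ^ j
  prime[2^e+1]⇒e≡2^j e 2ᵉ+1-prime
    with j , o , 2∤o , e≡2ʲo ← split-power (s<s z<s) e
    with 2∤⇒≡1+2k 2∤o
  ... | zero  , refl = j , trans e≡2ʲo (*-identityʳ (2 ^ j))
  ... | suc g , refl = contradiction (subst Prime factorised 2ᵉ+1-prime)
                                     (¬prime[m*n] (s<s (<-trans z<s 1<x)) (altGeomSum>1 g 1<x))
    where
    open ≡-Reasoning
    x : ℕ
    x = 2 ^ 2 ^ j
    instance
      x≢0 : NonZero x
      x≢0 = m^n≢0 2 (2 ^ j)
    1<x : 1 < x
    1<x = ^-monoʳ-< 2 (s<s z<s) (m^n>0 2 j)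
    factorised : 2 ^ e + 1 ≡ (1 + x) * altGeomSum x (suc g)
    factorised = begin
      2 ^ e + 1                      ≡⟨ cong (λ e → 2 ^ e + 1) e≡2ʲo ⟩
      2 ^ (2 ^ j * o) + 1            ≡⟨ cong (_+ 1) (^-*-assoc 2 (2 ^ j) o) ⟨
      x ^ o + 1                      ≡⟨ altGeomSum-factorises x (suc g) ⟨
      (1 + x) * altGeomSum x (suc g) ∎

  odd-square : ∀ t → (1 + 2 * t) * (1 + 2 * t) ≡ 1 + 4 * (t * (1 + t))
  odd-square = solve-∀

  ^-double : ∀ x g → x ^ (2 * g) ≡ x ^ g * x ^ g
  ^-double x g = trans (^-distribˡ-+-* x g (g + 0)) (cong (λ n → x ^ g * x ^ n) (+-identityʳ g))

  t[1+t]∣2^m⇒t≡0⊎t≡1 : ∀ t {m} → t * (1 + t) ∣ 2 ^ m → t ≡ 0 ⊎ t ≡ 1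
  t[1+t]∣2^m⇒t≡0⊎t≡1 t {m} t[1+t]∣2ᵐ with parity t
  ... | even u = inj₁ (suc-injective (2∤∧∣2^⇒≡1 m (2∤1+2k u) (∣-trans (n∣m*n (2 * u)) t[1+t]∣2ᵐ)))
  ... | odd u  = inj₂ (2∤∧∣2^⇒≡1 m (2∤1+2k u) (∣-trans (m∣m*n (2 + 2 * u)) t[1+t]∣2ᵐ))

  x^k≡2^m+1⇒x^k≡9 : ∀ {x} k {m} → ¬ 2 ∣ x → 1 < x → 1 < k → x ^ k ≡ 2 ^ m + 1 → x ^ k ≡ 9
  x^k≡2^m+1⇒x^k≡9 {x@(suc s)} k {m} 2∤x 1<x 1<k xᵏ≡2ᵐ+1 with parity k
  ... | odd zero    = contradiction 1<k (<-irrefl refl)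
  ... | odd (suc g) = contradiction (2∤∧∣2^⇒≡1 m (geomSum-odd 2∤x (suc g)) G∣2ᵐ) (>⇒≢ 1<G)
    where
    G∣2ᵐ : geomSum x k ∣ 2 ^ m
    G∣2ᵐ = divides s (sym (+-cancelʳ-≡ 1 _ _ (trans (geomSum-telescopes s k) xᵏ≡2ᵐ+1)))
    1<G : 1 < geomSum x k
    1<G = s≤s (s≤s z≤n)
  ... | even zero   = contradiction 1<k λ ()
  ... | even g@(suc g′) with t , xᵍ≡1+2t ← 2∤⇒≡1+2k (2∤^ 2∤x g) =
    case t[1+t]∣2^m⇒t≡0⊎t≡1 t {m} (divides 4 (sym 4t[1+t]≡2ᵐ)) of λ where
      (inj₁ refl) → contradiction xᵍ≡1+2t (>⇒≢ (1<x⇒1<x^[1+n] g′ 1<x))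
      (inj₂ refl) → trans (^-double x g) (cong₂ _*_ xᵍ≡1+2t xᵍ≡1+2t)
    where
    4t[1+t]≡2ᵐ : 4 * (t * (1 + t)) ≡ 2 ^ m
    4t[1+t]≡2ᵐ = suc-injective (begin
      1 + 4 * (t * (1 + t))         ≡⟨ odd-square t ⟨
      (1 + 2 * t) * (1 + 2 * t)     ≡⟨ cong₂ _*_ xᵍ≡1+2t xᵍ≡1+2t ⟨
      x ^ g * x ^ g                 ≡⟨ ^-double x g ⟨
      x ^ k                         ≡⟨ xᵏ≡2ᵐ+1 ⟩
      2 ^ m + 1                     ≡⟨ +-comm (2 ^ m) 1 ⟩
      1 + 2 ^ m                     ∎)
      where open ≡-Reasoning

  x^e+1≡2^k⇒e≡1 : ∀ {x} e {k} → .{{NonZero e}} → ¬ 2 ∣ x → 1 < x → x ^ e + 1 ≡ 2 ^ k → e ≡ 1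
  x^e+1≡2^k⇒e≡1 {x} e {k} 2∤x 1<x xᵉ+1≡2ᵏ with parity e
  ... | odd zero    = refl
  ... | odd (suc g) =
    contradiction (2∤∧∣2^⇒≡1 k (altGeomSum-odd 2∤x (suc g)) A∣2ᵏ) (>⇒≢ (altGeomSum>1 g 1<x))
    where
    instance
      x≢0 : NonZero x
      x≢0 = >-nonZero (<-trans z<s 1<x)
    A∣2ᵏ : altGeomSum x (suc g) ∣ 2 ^ k
    A∣2ᵏ = divides (1 + x) (sym (trans (altGeomSum-factorises x (suc g)) xᵉ+1≡2ᵏ))
  ... | even zero   = contradiction refl (≢-nonZero⁻¹ e)
  ... | even g@(suc g′) with t , xᵍ≡1+2t ← 2∤⇒≡1+2k (2∤^ 2∤x g) =
    contradiction (trans xᵍ≡1+2t (cong suc (cong (2 *_) t≡0))) (>⇒≢ (1<x⇒1<x^[1+n] g′ 1<x))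
    where
    open ≡-Reasoning
    2[1+2t[1+t]]≡2ᵏ : 2 * (1 + 2 * (t * (1 + t))) ≡ 2 ^ k
    2[1+2t[1+t]]≡2ᵏ = begin
      2 * (1 + 2 * (t * (1 + t)))       ≡⟨ regroup (t * (1 + t)) ⟩
      1 + 4 * (t * (1 + t)) + 1         ≡⟨ cong (_+ 1) (odd-square t) ⟨
      (1 + 2 * t) * (1 + 2 * t) + 1     ≡⟨ cong (λ y → y * y + 1) xᵍ≡1+2t ⟨
      x ^ g * x ^ g + 1                 ≡⟨ cong (_+ 1) (^-double x g) ⟨
      x ^ e + 1                         ≡⟨ xᵉ+1≡2ᵏ ⟩
      2 ^ k                             ∎
      where
      regroup : ∀ T → 2 * (1 + 2 * T) ≡ 1 + 4 * T + 1
      regroup = solve-∀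
    t≡0 : t ≡ 0
    t≡0 = m*n≡0⇒m≡0 t (1 + t) (m+n≡0⇒m≡0 _ (suc-injective
            (2∤∧∣2^⇒≡1 k (2∤1+2k (t * (1 + t))) (divides 2 (sym 2[1+2t[1+t]]≡2ᵏ)))))

  ListedOrder : ℕ → Set
  ListedOrder n = n ≡ 2 ⊎ n ≡ 9 ⊎ FermatPrime n ⊎ ∃ λ q → MersennePrime q × n ≡ q + 1

  primePower≡2^e+1⇒9⊎fermat : ∀ {n p} k e → .{{NonZero e}} → Prime p → n ≡ p ^ k → n ≡ 2 ^ e + 1 →
                              n ≡ 9 ⊎ FermatPrime n
  primePower≡2^e+1⇒9⊎fermat zero e _ n≡1 n≡2ᵉ+1 =
    contradiction (sym (+-cancelʳ-≡ 1 0 (2 ^ e) (trans (sym n≡1) n≡2ᵉ+1)))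
                  (≢-nonZero⁻¹ (2 ^ e) {{m^n≢0 2 e}})
  primePower≡2^e+1⇒9⊎fermat {n} {p} 1 e p-prime n≡p n≡2ᵉ+1 =
    inj₂ (n-prime , map₂ (trans n≡2ᵉ+1 ∘ cong (λ e → 2 ^ e + 1))
                         (prime[2^e+1]⇒e≡2^j e (subst Prime n≡2ᵉ+1 n-prime)))
    where
    n-prime : Prime n
    n-prime = subst Prime (sym (trans n≡p (*-identityʳ p))) p-prime
  primePower≡2^e+1⇒9⊎fermat {n} {p} k@(suc k′@(suc _)) e@(suc e′) p-prime n≡pᵏ n≡2ᵉ+1 =
    inj₁ (trans n≡pᵏ (x^k≡2^m+1⇒x^k≡9 k {e} 2∤p (prime>1 p-prime) (s<s z<s)
                                       (trans (sym n≡pᵏ) n≡2ᵉ+1)))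
    where
    2∤p : ¬ 2 ∣ p
    2∤p 2∣p = 2∤1+2k (2 ^ e′)
      (subst (2 ∣_) (trans (sym n≡pᵏ) (trans n≡2ᵉ+1 (+-comm (2 ^ e) 1))) (∣m⇒∣m*n (p ^ k′) 2∣p))

  primePower≡r^e+1⇒mersenne : ∀ {n p r} k e → .{{NonZero e}} → Prime p → Prime r → ¬ 2 ∣ r →
                              n ≡ p ^ k → n ≡ r ^ e + 1 → MersennePrime r × n ≡ r + 1
  primePower≡r^e+1⇒mersenne {n} {p} {r} k e p-prime r-prime 2∤r n≡pᵏ n≡rᵉ+1 =
    (r-prime , k , sym r≡2ᵏ∸1) , n≡r+1
    where
    2∣n : 2 ∣ n
    2∣n with t , rᵉ≡1+2t ← 2∤⇒≡1+2k (2∤^ 2∤r e) =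
      divides (1 + t) (trans n≡rᵉ+1 (trans (cong (_+ 1) rᵉ≡1+2t) (regroup t)))
      where
      regroup : ∀ t → 1 + 2 * t + 1 ≡ (1 + t) * 2
      regroup = solve-∀
    p≡2 : p ≡ 2
    p≡2 = prime∧2∣⇒≡2 p-prime (prime∣^⇒∣ k prime[2] (subst (2 ∣_) n≡pᵏ 2∣n))
    e≡1 : e ≡ 1
    e≡1 = x^e+1≡2^k⇒e≡1 e {k} 2∤r (prime>1 r-prime)
            (trans (sym n≡rᵉ+1) (trans n≡pᵏ (cong (_^ k) p≡2)))
    n≡r+1 : n ≡ r + 1
    n≡r+1 = trans n≡rᵉ+1 (cong (_+ 1) (trans (cong (r ^_) e≡1) (*-identityʳ r)))
    r≡2ᵏ∸1 : 2 ^ k ∸ 1 ≡ r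
    r≡2ᵏ∸1 = trans (cong (_∸ 1) (trans (cong (_^ k) (sym p≡2)) (trans (sym n≡pᵏ) n≡r+1)))
                   (m+n∸n≡m r 1)

  primePower∧primePower⇒listed : ∀ {m} → IsPrimePower (suc m) → IsPrimePower m → ListedOrder (suc m)
  primePower∧primePower⇒listed (_ , _ , _ , _) (_ , zero , _ , m≡1) = inj₁ (cong suc m≡1)
  primePower∧primePower⇒listed {m} (p , k , p-prime , 1+m≡pᵏ) (r , e@(suc _) , r-prime , m≡rᵉ)
    with prime⇒≡2⊎2∤ r-prime
  ... | inj₁ refl = inj₂ (Sum.map₂ inj₁ (primePower≡2^e+1⇒9⊎fermat k e p-prime 1+m≡pᵏ 1+m≡rᵉ+1))
    where
    1+m≡rᵉ+1 : suc m ≡ 2 ^ e + 1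
    1+m≡rᵉ+1 = trans (cong suc m≡rᵉ) (+-comm 1 (2 ^ e))
  ... | inj₂ 2∤r  =
    inj₂ (inj₂ (inj₂ (r , primePower≡r^e+1⇒mersenne k e p-prime r-prime 2∤r 1+m≡pᵏ 1+m≡rᵉ+1)))
    where
    1+m≡rᵉ+1 : suc m ≡ r ^ e + 1
    1+m≡rᵉ+1 = trans (cong suc m≡rᵉ) (+-comm 1 (r ^ e))

  listed⇒primePower : ∀ {m} → ListedOrder (suc m) → IsPrimePower m
  listed⇒primePower (inj₁ refl)                                   = 2 , 0 , prime[2] , refl
  listed⇒primePower (inj₂ (inj₁ refl))                            = 2 , 3 , prime[2] , refl
  listed⇒primePower (inj₂ (inj₂ (inj₁ (_ , j , 1+m≡2^2ʲ+1))))      =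
    2 , 2 ^ j , prime[2] , suc-injective (trans 1+m≡2^2ʲ+1 (+-comm _ 1))
  listed⇒primePower (inj₂ (inj₂ (inj₂ (q , (q-prime , _) , 1+m≡q+1)))) =
    q , 1 , q-prime , trans (suc-injective (trans 1+m≡q+1 (+-comm q 1))) (sym (*-identityʳ q))

open Arithmetic

import Algebra.Properties.CommutativeSemiring.Exp as CommutativeSemiringExp
import Algebra.Properties.Ring as RingProperties
import Algebra.Properties.Semiring.Exp as SemiringExp
import Algebra.Properties.Semiring.Mult as SemiringMult
open import Data.Fin.Base as Fin using (Fin; toℕ)
import Data.Fin.Properties as Fin
open import Data.Fin.Permutation using (Permutation; permutation; _⟨$⟩ʳ_; ↔⇒≡)
open import Data.List.Base using (_∷_)
open import Data.List.Relation.Unary.All using (All; []; _∷_)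
open import Data.Nat.Base as ℕ using (ℕ; zero; suc; _≤_; _<_; s≤s; z≤n; NonZero)
open import Data.Nat.Coprimality using (Coprime; coprime-Bézout; prime⇒coprime)
open import Data.Nat.DivMod using (_%_; _/_; m≡m%n+[m/n]*n; m%n<n)
open import Data.Nat.GCD using (module Bézout)
open import Data.Nat.ListAction using (product)
open import Data.Nat.Primality using (Prime; prime⇒nonZero)
open import Data.Nat.Primality.Factorisation using (PrimeFactorisation; factorise; module PrimeFactorisation)
import Data.Nat.Properties as ℕ
open import Data.Nat.Tactic.RingSolver using (solve-∀)
open import Data.Product.Base using (Σ; ∃; _×_; _,_; proj₁; proj₂; map; uncurry)
open import Data.Sum.Base using (_⊎_; inj₁; inj₂)
open import Data.Vec.Base using (Vec; []; _∷_; replicate)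
open import Function.Base using (_∘_)
open import Function.Bundles using (Inverse; _⇔_; mk⇔; Equivalence)
open import Function.Construct.Composition using (_⇔-∘_)
import Function.Construct.Composition as Composition
import Function.Construct.Symmetry as Symmetry
open import Level using (_⊔_)
open import Relation.Binary.Definitions using (Decidable)
open import Relation.Binary.PropositionalEquality as ≡ using (_≡_)
open import Relation.Nullary using (¬_; Dec; yes; no; contradiction)
open import Relation.Nullary.Decidable using (map′)
open import Relation.Unary using (Pred)

module FieldProperties {c ℓ} (F : Field c ℓ) where
  open Field F
  open Units F
  open RingProperties ring using (x[y-z]≈xy-xz; [y-z]x≈yx-zx; x∙y⁻¹≈ε⇒x≈y; x≈y⇒x∙y⁻¹≈ε)
  open SemiringExp semiring using (_^_; ^-congˡ; ^-congʳ; ^-homo-*; ^-assocʳ)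
  open CommutativeSemiringExp commutativeSemiring using (^-distrib-*)
  open import Algebra.Solver.Ring.NaturalCoefficients.Default commutativeSemiring
    using (solve; _:+_; _:*_; _:=_; con)
  open import Relation.Binary.Reasoning.Setoid setoid

  x*y≈0⇒y≈0 : ∀ {x y} → x ≉ 0# → x * y ≈ 0# → y ≈ 0#
  x*y≈0⇒y≈0 {x} {y} x≉0 xy≈0 with x⁻¹ , xx⁻¹≈1 ← inverse x x≉0 = begin
    y              ≈⟨ *-identityˡ y ⟨
    1# * y         ≈⟨ *-congʳ xx⁻¹≈1 ⟨
    x * x⁻¹ * y    ≈⟨ *-congʳ (*-comm x x⁻¹) ⟩
    x⁻¹ * x * y    ≈⟨ *-assoc x⁻¹ x y ⟩
    x⁻¹ * (x * y)  ≈⟨ *-congˡ xy≈0 ⟩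
    x⁻¹ * 0#       ≈⟨ zeroʳ x⁻¹ ⟩
    0#             ∎

  x≉0∧y≉0⇒x*y≉0 : ∀ {x y} → x ≉ 0# → y ≉ 0# → x * y ≉ 0#
  x≉0∧y≉0⇒x*y≉0 x≉0 y≉0 xy≈0 = y≉0 (x*y≈0⇒y≈0 x≉0 xy≈0)

  *-cancelˡ : ∀ {x y z} → x ≉ 0# → x * y ≈ x * z → y ≈ z
  *-cancelˡ {x} {y} {z} x≉0 xy≈xz =
    x∙y⁻¹≈ε⇒x≈y y z (x*y≈0⇒y≈0 x≉0 (trans (x[y-z]≈xy-xz x y z) (x≈y⇒x∙y⁻¹≈ε xy≈xz)))

  x*z≈y*z⇒z≈0 : ∀ {x y z} → x ≉ y → x * z ≈ y * z → z ≈ 0#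
  x*z≈y*z⇒z≈0 {x} {y} {z} x≉y xz≈yz =
    x*y≈0⇒y≈0 (x≉y ∘ x∙y⁻¹≈ε⇒x≈y x y)
              (trans ([y-z]x≈yx-zx z x y) (x≈y⇒x∙y⁻¹≈ε xz≈yz))

  x^n≉0 : ∀ {x} → x ≉ 0# → ∀ n → x ^ n ≉ 0#
  x^n≉0 x≉0 zero    = 1≉0
  x^n≉0 x≉0 (suc n) = x≉0∧y≉0⇒x*y≉0 x≉0 (x^n≉0 x≉0 n)

  1^n≈1 : ∀ n → 1# ^ n ≈ 1#
  1^n≈1 zero    = refl
  1^n≈1 (suc n) = trans (*-identityˡ _) (1^n≈1 n)

  x^a≈1⇒x^[n*a]≈1 : ∀ {x a} n → x ^ a ≈ 1# → x ^ (n ℕ.* a) ≈ 1#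
  x^a≈1⇒x^[n*a]≈1 {x} {a} n xᵃ≈1 = begin
    x ^ (n ℕ.* a)  ≈⟨ ^-congʳ x (ℕ.*-comm n a) ⟩
    x ^ (a ℕ.* n)  ≈⟨ ^-assocʳ x a n ⟨
    (x ^ a) ^ n    ≈⟨ ^-congˡ n xᵃ≈1 ⟩
    1# ^ n         ≈⟨ 1^n≈1 n ⟩
    1#             ∎

  x^m≈1∧x^[1+m]≈1⇒x≈1 : ∀ {x m} → x ^ m ≈ 1# → x ^ suc m ≈ 1# → x ≈ 1#
  x^m≈1∧x^[1+m]≈1⇒x≈1 {x} {m} xᵐ≈1 x¹⁺ᵐ≈1 = begin
    x          ≈⟨ *-identityʳ x ⟨
    x * 1#     ≈⟨ *-congˡ xᵐ≈1 ⟨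
    x * x ^ m  ≈⟨ x¹⁺ᵐ≈1 ⟩
    1#         ∎

  coprime-exponents⇒≈1 : ∀ {x a b} → Coprime a b → x ^ a ≈ 1# → x ^ b ≈ 1# → x ≈ 1#
  coprime-exponents⇒≈1 {x} {a} {b} coprime xᵃ≈1 xᵇ≈1 with coprime-Bézout coprime
  ... | Bézout.+- i j 1+jb≡ia = x^m≈1∧x^[1+m]≈1⇒x≈1 {m = j ℕ.* b} (x^a≈1⇒x^[n*a]≈1 j xᵇ≈1)
          (trans (^-congʳ x 1+jb≡ia) (x^a≈1⇒x^[n*a]≈1 i xᵃ≈1))
  ... | Bézout.-+ i j 1+ia≡jb = x^m≈1∧x^[1+m]≈1⇒x≈1 {m = i ℕ.* a} (x^a≈1⇒x^[n*a]≈1 i xᵃ≈1)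
          (trans (^-congʳ x 1+ia≡jb) (x^a≈1⇒x^[n*a]≈1 j xᵇ≈1))

  -- A monic polynomial of degree k, given by its k lower coefficients, constant term first.
  Monic : ℕ → Set c
  Monic = Vec Carrier

  eval : ∀ {k} → Monic k → Carrier → Carrier
  eval []       x = 1#
  eval (a ∷ as) x = a + x * eval as x

  -- Synthetic division by x − r: the quotient's coefficients are the intermediate values of the
  -- Horner evaluation at r, and quotient-correct says P(x) = (x − r) Q(x) + P(r).
  quotient : ∀ {k} → Carrier → Monic (suc k) → Monic k
  quotient r (a ∷ [])         = []
  quotient r (a ∷ as@(_ ∷ _)) = eval as r ∷ quotient r as

  quotient-correct : ∀ {k} r (P : Monic (suc k)) x →
                     eval P x + r * eval (quotient r P) x ≈ x * eval (quotient r P) x + eval P r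
  quotient-correct r (a ∷ []) x =
    solve 3 (λ a x r → a :+ x :* con 1 :+ r :* con 1 := x :* con 1 :+ (a :+ r :* con 1)) refl a x r
  quotient-correct r (a ∷ as@(_ ∷ _)) x = begin
    a + x * P + r * (E + x * Q)   ≈⟨ solve 6 (λ a x P r E Q → a :+ x :* P :+ r :* (E :+ x :* Q)
                                                             := a :+ r :* E :+ x :* (P :+ r :* Q)) refl a x P r E Q ⟩
    a + r * E + x * (P + r * Q)   ≈⟨ +-congˡ (*-congˡ (quotient-correct r as x)) ⟩
    a + r * E + x * (x * Q + E)   ≈⟨ solve 5 (λ a r E x Q → a :+ r :* E :+ x :* (x :* Q :+ E)
                                                           := x :* (E :+ x :* Q) :+ (a :+ r :* E)) refl a r E x Q ⟩
    x * (E + x * Q) + (a + r * E) ∎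
    where
    P E Q : Carrier
    P = eval as x
    E = eval as r
    Q = eval (quotient r as) x

  roots-bound : ∀ {k m} (P : Monic k) (root : Fin m → Carrier) →
                (∀ {i j} → root i ≈ root j → i ≡ j) → (∀ i → eval P (root i) ≈ 0#) → m ≤ k
  roots-bound {m = zero}      _  _    _         _      = z≤n
  roots-bound {zero}  {suc _} [] root _         isRoot = contradiction (isRoot Fin.zero) 1≉0
  roots-bound {suc k} {suc _} P  root injective isRoot =
    s≤s (roots-bound (quotient r P) (root ∘ Fin.suc) (Fin.suc-injective ∘ injective) isRootQ)
    where
    r : Carrier
    r = root Fin.zero
    isRootQ : ∀ i → eval (quotient r P) (root (Fin.suc i)) ≈ 0#
    isRootQ i = x*z≈y*z⇒z≈0 (λ r≈s → Fin.0≢1+n (injective r≈s)) (begin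
      r * Q             ≈⟨ +-identityˡ (r * Q) ⟨
      0# + r * Q        ≈⟨ +-congʳ (isRoot (Fin.suc i)) ⟨
      eval P s + r * Q  ≈⟨ quotient-correct r P s ⟩
      s * Q + eval P r  ≈⟨ +-congˡ (isRoot Fin.zero) ⟩
      s * Q + 0#        ≈⟨ +-identityʳ (s * Q) ⟩
      s * Q             ∎)
      where
      s Q : Carrier
      s = root (Fin.suc i)
      Q = eval (quotient r P) s

  eval[x^[1+n]-1] : ∀ n x → eval (- 1# ∷ replicate n 0#) x ≈ - 1# + x ^ suc n
  eval[x^[1+n]-1] n x = +-congˡ (*-congˡ (eval[x^n] n))
    where
    eval[x^n] : ∀ n → eval (replicate n 0#) x ≈ x ^ n
    eval[x^n] zero    = refl
    eval[x^n] (suc n) = trans (+-identityˡ _) (*-congˡ (eval[x^n] n))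

  roots-of-unity-bound : ∀ {m} n → .{{NonZero n}} → (root : Fin m → Carrier) →
                         (∀ {i j} → root i ≈ root j → i ≡ j) → (∀ i → root i ^ n ≈ 1#) → m ≤ n
  roots-of-unity-bound (suc n) root injective isRoot =
    roots-bound (- 1# ∷ replicate n 0#) root injective λ i →
      trans (eval[x^[1+n]-1] n (root i)) (trans (+-congˡ (isRoot i)) (-‿inverseˡ 1#))

  μ : ℕ → Pred Unit ℓ
  μ n u = proj₁ u ^ n ≈ 1#

  μ-isSubgroup : ∀ n → IsSubgroup (μ n)
  μ-isSubgroup n = record
    { resp = λ u≈v uⁿ≈1 → trans (^-congˡ n (sym u≈v)) uⁿ≈1
    ; has1 = λ _ → 1^n≈1 n
    ; mul  = λ {u} {v} _ uⁿ≈1 vⁿ≈1 → begin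
        (proj₁ u * proj₁ v) ^ n        ≈⟨ ^-distrib-* (proj₁ u) (proj₁ v) n ⟩
        proj₁ u ^ n * proj₁ v ^ n      ≈⟨ *-cong uⁿ≈1 vⁿ≈1 ⟩
        1# * 1#                        ≈⟨ *-identityˡ 1# ⟩
        1#                             ∎
    ; inv  = λ {u} {v} uv≈1 uⁿ≈1 → begin
        proj₁ v ^ n                    ≈⟨ *-identityˡ _ ⟨
        1# * proj₁ v ^ n               ≈⟨ *-congʳ uⁿ≈1 ⟨
        proj₁ u ^ n * proj₁ v ^ n      ≈⟨ ^-distrib-* (proj₁ u) (proj₁ v) n ⟨
        (proj₁ u * proj₁ v) ^ n        ≈⟨ ^-congˡ n uv≈1 ⟩
        1# ^ n                         ≈⟨ 1^n≈1 n ⟩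
        1#                             ∎
    }

  _^ᵘ_ : Unit → ℕ → Unit
  u ^ᵘ n = proj₁ u ^ n , x^n≉0 (proj₂ u) n

  subgroup-^ : ∀ {H} → IsSubgroup H → ∀ {u} → H u → ∀ n → H (u ^ᵘ n)
  subgroup-^ H-subgroup Hu zero    = IsSubgroup.has1 H-subgroup _
  subgroup-^ H-subgroup Hu (suc n) = IsSubgroup.mul H-subgroup _ Hu (subgroup-^ H-subgroup Hu n)

  module _ {r} (r-prime : Prime r) (h : Unit) (h≉1 : proj₁ h ≉ 1#) (h∈μʳ : μ r h) where

    h^c≈1⇒c≡0 : ∀ {c} → c < r → proj₁ h ^ c ≈ 1# → c ≡ 0
    h^c≈1⇒c≡0 {zero}  _   _     = ≡.refl
    h^c≈1⇒c≡0 {suc c} c<r hᶜ≈1 =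
      contradiction (coprime-exponents⇒≈1 (prime⇒coprime r-prime c<r) h∈μʳ hᶜ≈1) h≉1

    h^i≈h^j⇒j≤i : ∀ {i j} → i ≤ j → j < r → proj₁ h ^ i ≈ proj₁ h ^ j → j ≤ i
    h^i≈h^j⇒j≤i {i} {j} i≤j j<r hⁱ≈hʲ =
      ℕ.m∸n≡0⇒m≤n (h^c≈1⇒c≡0 (ℕ.≤-<-trans (ℕ.m∸n≤m j i) j<r) (sym (*-cancelˡ (x^n≉0 (proj₂ h) i) (begin
        proj₁ h ^ i * 1#                   ≈⟨ *-identityʳ _ ⟩
        proj₁ h ^ i                        ≈⟨ hⁱ≈hʲ ⟩
        proj₁ h ^ j                        ≈⟨ ^-congʳ (proj₁ h) (ℕ.m+[n∸m]≡n i≤j) ⟨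
        proj₁ h ^ (i ℕ.+ (j ℕ.∸ i))        ≈⟨ ^-homo-* (proj₁ h) i (j ℕ.∸ i) ⟩
        proj₁ h ^ i * proj₁ h ^ (j ℕ.∸ i)  ∎))))

    ^-injective-below : ∀ {i j} → i < r → j < r → proj₁ h ^ i ≈ proj₁ h ^ j → i ≡ j
    ^-injective-below {i} {j} i<r j<r hⁱ≈hʲ with ℕ.≤-total i j
    ... | inj₁ i≤j = ℕ.≤-antisym i≤j (h^i≈h^j⇒j≤i i≤j j<r hⁱ≈hʲ)
    ... | inj₂ j≤i = ℕ.≤-antisym (h^i≈h^j⇒j≤i j≤i i<r (sym hⁱ≈hʲ)) j≤i

  module _ (_≟_ : Decidable _≈_) where

    nontrivial-root-of-unity : ∀ {H} → IsSubgroup H → ∀ r e {u} → H u → proj₁ u ≉ 1# → μ (r ℕ.^ e) u →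
                               ∃ λ h → H h × proj₁ h ≉ 1# × μ r h
    nontrivial-root-of-unity H-subgroup r zero    Hu u≉1 u¹≈1 =
      contradiction (trans (sym (*-identityʳ _)) u¹≈1) u≉1
    nontrivial-root-of-unity H-subgroup r (suc e) {u} Hu u≉1 u∈μ with (proj₁ u ^ (r ℕ.^ e)) ≟ 1#
    ... | yes u∈μ′ = nontrivial-root-of-unity H-subgroup r e Hu u≉1 u∈μ′
    ... | no  u∉μ′ = u ^ᵘ (r ℕ.^ e) , subgroup-^ H-subgroup Hu (r ℕ.^ e) , u∉μ′ , (begin
      (proj₁ u ^ (r ℕ.^ e)) ^ r  ≈⟨ ^-assocʳ (proj₁ u) (r ℕ.^ e) r ⟩
      proj₁ u ^ (r ℕ.^ e ℕ.* r)  ≈⟨ ^-congʳ (proj₁ u) (ℕ.*-comm (r ℕ.^ e) r) ⟩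
      proj₁ u ^ (r ℕ.^ suc e)    ≈⟨ u∈μ ⟩
      1#                         ∎)

    -- With h of order r in H and k ≠ 1 in K, the elements k, 1, h, …, h ^ (r − 1) are r + 1
    -- distinct roots of x ^ r = 1: k is no power of h as H ∩ K = {1}.
    primePower-exponent⇒indecomposable : ∀ {r e} → Prime r → (∀ u → μ (r ℕ.^ e) u) → Indecomposable
    primePower-exponent⇒indecomposable {r} {e} r-prime exponent
      (H , K , H-subgroup , K-subgroup , (u , Hu , u≉1) , (v , Kv , v≉1) , H∩K⊆1 , _)
      with h , Hh , h≉1 , h∈μʳ ← nontrivial-root-of-unity H-subgroup r e Hu u≉1 (exponent u)
         | k , Kk , k≉1 , k∈μʳ ← nontrivial-root-of-unity K-subgroup r e Kv v≉1 (exponent v)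
      = ℕ.<-irrefl ≡.refl (roots-of-unity-bound r {{prime⇒nonZero r-prime}} root root-injective root∈μʳ)
      where
      root : Fin (suc r) → Carrier
      root Fin.zero    = proj₁ k
      root (Fin.suc i) = proj₁ h ^ toℕ i
      k∉⟨h⟩ : ∀ i → proj₁ k ≉ proj₁ h ^ i
      k∉⟨h⟩ i k≈hⁱ = k≉1 (H∩K⊆1 k (IsSubgroup.resp H-subgroup (sym k≈hⁱ) (subgroup-^ H-subgroup Hh i)) Kk)
      root-injective : ∀ {i j} → root i ≈ root j → i ≡ j
      root-injective {Fin.zero}  {Fin.zero}  _     = ≡.refl
      root-injective {Fin.zero}  {Fin.suc j} k≈hʲ = contradiction k≈hʲ (k∉⟨h⟩ (toℕ j))
      root-injective {Fin.suc i} {Fin.zero}  hⁱ≈k = contradiction (sym hⁱ≈k) (k∉⟨h⟩ (toℕ i))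
      root-injective {Fin.suc i} {Fin.suc j} hⁱ≈hʲ = ≡.cong Fin.suc
        (Fin.toℕ-injective (^-injective-below r-prime h h≉1 h∈μʳ (Fin.toℕ<n i) (Fin.toℕ<n j) hⁱ≈hʲ))
      root∈μʳ : ∀ i → root i ^ r ≈ 1#
      root∈μʳ Fin.zero    = k∈μʳ
      root∈μʳ (Fin.suc i) = trans (^-assocʳ (proj₁ h) (toℕ i) r) (x^a≈1⇒x^[n*a]≈1 (toℕ i) h∈μʳ)

module FiniteFieldProperties {c ℓ} (F : Field c ℓ) {m : ℕ} (enum : HasCard F (suc m)) where
  open Field F
  open Units F
  open FieldProperties F
  open Inverse enum using (to; from; to-cong; from-cong; strictlyInverseˡ; strictlyInverseʳ)
  open import Algebra.Properties.CommutativeMonoid.Sum *-commutativeMonoid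
    using (sum-cong-≋; ∑-distrib-+; ∑-permute; sum-replicate) renaming (sum to ∏)
  open import Algebra.Properties.CommutativeSemigroup +-commutativeSemigroup using (interchange)
  open RingProperties ring using (+-cancelˡ; +-inverseˡ-unique; +-inverseʳ-unique)
  open SemiringExp semiring using (_^_; ^-congʳ; ^-assocʳ; ^-homo-*)
  open SemiringMult semiring
    using (×-homo-+; ×-congˡ; ×-congʳ; ×-assoc-*; ×-assocˡ; ×1-homo-*) renaming (_×_ to _·_)
  open import Relation.Binary.Reasoning.Setoid setoid

  from-injective : ∀ {x y} → from x ≡ from y → x ≈ y
  from-injective {x} {y} fx≡fy = trans (sym (strictlyInverseˡ x)) (trans (to-cong fx≡fy) (strictlyInverseˡ y))

  to-injective : ∀ {i j} → to i ≈ to j → i ≡ j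
  to-injective {i} {j} ti≈tj =
    ≡.trans (≡.sym (strictlyInverseʳ i)) (≡.trans (from-cong ti≈tj) (strictlyInverseʳ j))

  _≟_ : Decidable _≈_
  x ≟ y = map′ from-injective from-cong (from x Fin.≟ from y)

  unit : Fin m → Unit
  unit i = to (Fin.punchIn (from 0#) i) , λ tᵢ≈0 →
    Fin.punchInᵢ≢i (from 0#) i (≡.trans (≡.sym (strictlyInverseʳ _)) (from-cong tᵢ≈0))

  unit-injective : ∀ {i j} → unit i ≈ᵘ unit j → i ≡ j
  unit-injective uᵢ≈uⱼ = Fin.punchIn-injective (from 0#) _ _ (to-injective uᵢ≈uⱼ)

  indexOf : Unit → Fin m
  indexOf (x , x≉0) = Fin.punchOut {i = from 0#} {j = from x} (λ f0≡fx → x≉0 (from-injective (≡.sym f0≡fx)))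

  unit-indexOf : ∀ u → unit (indexOf u) ≈ᵘ u
  unit-indexOf (x , _) = trans (to-cong (Fin.punchIn-punchOut _)) (strictlyInverseˡ x)

  _*ᵘ_ : Unit → Unit → Unit
  u *ᵘ v = proj₁ u * proj₁ v , x≉0∧y≉0⇒x*y≉0 (proj₂ u) (proj₂ v)

  inverseᵘ : ∀ u → ∃ λ v → proj₁ u * proj₁ v ≈ 1#
  inverseᵘ (x , x≉0) with y , xy≈1 ← inverse x x≉0 =
    (y , λ y≈0 → 1≉0 (trans (sym xy≈1) (trans (*-congˡ y≈0) (zeroʳ x)))) , xy≈1

  multiplication-permutation : Unit → Permutation m m
  multiplication-permutation u with v , uv≈1 ← inverseᵘ u =
    permutation (times u) (times v) (cancels u v uv≈1) (cancels v u (trans (*-comm _ _) uv≈1))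
    where
    times : Unit → Fin m → Fin m
    times u i = indexOf (u *ᵘ unit i)
    cancels : ∀ u v → proj₁ u * proj₁ v ≈ 1# → ∀ i → times u (times v i) ≡ i
    cancels u v uv≈1 i = unit-injective (begin
      proj₁ (unit (times u (times v i)))    ≈⟨ unit-indexOf (u *ᵘ unit (times v i)) ⟩
      proj₁ u * proj₁ (unit (times v i))    ≈⟨ *-congˡ (unit-indexOf (v *ᵘ unit i)) ⟩
      proj₁ u * (proj₁ v * proj₁ (unit i))  ≈⟨ *-assoc _ _ _ ⟨
      proj₁ u * proj₁ v * proj₁ (unit i)    ≈⟨ *-congʳ uv≈1 ⟩
      1# * proj₁ (unit i)                   ≈⟨ *-identityˡ _ ⟩
      proj₁ (unit i)                        ∎)

  ∏-≉0 : ∀ {n} (f : Fin n → Carrier) → (∀ i → f i ≉ 0#) → ∏ f ≉ 0#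
  ∏-≉0 {zero}  f f≉0 = 1≉0
  ∏-≉0 {suc n} f f≉0 = x≉0∧y≉0⇒x*y≉0 (f≉0 Fin.zero) (∏-≉0 (f ∘ Fin.suc) (f≉0 ∘ Fin.suc))

  fermat : ∀ u → μ m u
  fermat u@(x , _) = *-cancelˡ (∏-≉0 f (proj₂ ∘ unit)) (begin
    ∏ f * x ^ m                 ≈⟨ *-comm _ _ ⟩
    x ^ m * ∏ f                 ≈⟨ *-congʳ (sum-replicate m) ⟨
    ∏ {m} (λ _ → x) * ∏ f       ≈⟨ ∑-distrib-+ (λ _ → x) f ⟨
    ∏ (λ i → x * f i)           ≈⟨ sum-cong-≋ (λ i → sym (unit-indexOf (u *ᵘ unit i))) ⟩
    ∏ (λ i → f (π ⟨$⟩ʳ i))      ≈⟨ ∑-permute f π ⟨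
    ∏ f                         ≈⟨ *-identityʳ _ ⟨
    ∏ f * 1#                    ∎)
    where
    f : Fin m → Carrier
    f = proj₁ ∘ unit
    π : Permutation m m
    π = multiplication-permutation u

  ∃-vanishing-multiple : ∃ λ n → NonZero n × n · 1# ≈ 0#
  ∃-vanishing-multiple with i , j , i<j , fi≡fj ← Fin.pigeonhole (ℕ.n<1+n (suc m)) (λ i → from (toℕ i · 1#))
    = toℕ j ℕ.∸ toℕ i , ℕ.>-nonZero (ℕ.m<n⇒0<n∸m i<j) , +-cancelˡ (toℕ i · 1#) _ _ (begin
      toℕ i · 1# + (toℕ j ℕ.∸ toℕ i) · 1#  ≈⟨ ×-homo-+ 1# (toℕ i) _ ⟨
      (toℕ i ℕ.+ (toℕ j ℕ.∸ toℕ i)) · 1#  ≈⟨ ×-congˡ (ℕ.m+[n∸m]≡n (ℕ.<⇒≤ i<j)) ⟩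
      toℕ j · 1#                          ≈⟨ from-injective fi≡fj ⟨
      toℕ i · 1#                          ≈⟨ +-identityʳ _ ⟨
      toℕ i · 1# + 0#                     ∎)

  vanishing-prime-factor : ∀ {ps} → All Prime ps → product ps · 1# ≈ 0# → ∃ λ p → Prime p × p · 1# ≈ 0#
  vanishing-prime-factor [] 1·1≈0 = contradiction (trans (sym (+-identityʳ 1#)) 1·1≈0) 1≉0
  vanishing-prime-factor {p ∷ ps} (p-prime ∷ ps-prime) pps·1≈0 with (p · 1#) ≟ 0#
  ... | yes p·1≈0 = p , p-prime , p·1≈0
  ... | no  p·1≉0 = vanishing-prime-factor ps-prime
                      (x*y≈0⇒y≈0 p·1≉0 (trans (sym (×1-homo-* p (product ps))) pps·1≈0))

  characteristic : ∃ λ p → Prime p × p · 1# ≈ 0#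
  characteristic with n , n≢0 , n·1≈0 ← ∃-vanishing-multiple =
    vanishing-prime-factor (factorsPrime f) (trans (×-congˡ (≡.sym (isFactorisation f))) n·1≈0)
    where
    open PrimeFactorisation using (factorsPrime; isFactorisation)
    f : PrimeFactorisation n
    f = factorise n {{n≢0}}

  module _ {p} (p-prime : Prime p) (p·1≈0 : p · 1# ≈ 0#) where

    private instance
      p≢0 : NonZero p
      p≢0 = prime⇒nonZero p-prime

    [q*p]·x≈0 : ∀ q x → (q ℕ.* p) · x ≈ 0#
    [q*p]·x≈0 q x = begin
      (q ℕ.* p) · x              ≈⟨ ×-congʳ (q ℕ.* p) (*-identityˡ x) ⟨
      (q ℕ.* p) · (1# * x)       ≈⟨ ×-assoc-* (q ℕ.* p) 1# x ⟨
      (q ℕ.* p) · 1# * x         ≈⟨ *-congʳ (×1-homo-* q p) ⟩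
      q · 1# * (p · 1#) * x      ≈⟨ *-congʳ (*-congˡ p·1≈0) ⟩
      q · 1# * 0# * x            ≈⟨ *-congʳ (zeroʳ _) ⟩
      0# * x                     ≈⟨ zeroˡ x ⟩
      0#                         ∎

    ·-mod : ∀ n x → (n % p) · x ≈ n · x
    ·-mod n x = sym (begin
      n · x                                  ≈⟨ ×-congˡ (m≡m%n+[m/n]*n n p) ⟩
      (n % p ℕ.+ (n / p) ℕ.* p) · x          ≈⟨ ×-homo-+ x (n % p) _ ⟩
      (n % p) · x + ((n / p) ℕ.* p) · x      ≈⟨ +-congˡ ([q*p]·x≈0 (n / p) x) ⟩
      (n % p) · x + 0#                       ≈⟨ +-identityʳ _ ⟩
      (n % p) · x                            ∎)

    -x≈[p-1]·x : ∀ x → - x ≈ (p ℕ.∸ 1) · x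
    -x≈[p-1]·x x = sym (+-inverseʳ-unique x _ (begin
      x + (p ℕ.∸ 1) · x   ≡⟨⟩
      suc (p ℕ.∸ 1) · x   ≈⟨ ×-congˡ (ℕ.suc-pred p) ⟩
      p · x               ≈⟨ ×-congˡ (ℕ.*-identityˡ p) ⟨
      (1 ℕ.* p) · x       ≈⟨ [q*p]·x≈0 1 x ⟩
      0#                  ∎))

    -- An additive subgroup with s elements, listed without repetition. In characteristic p it
    -- is a vector space over F_p, so adjoining an element outside it multiplies its size by p.
    record AdditiveSubgroup (s : ℕ) : Set (c ⊔ ℓ) where
      field
        elem           : Fin s → Carrier
        elem-injective : ∀ {i j} → elem i ≈ elem j → i ≡ j
        0∈             : ∃ λ i → elem i ≈ 0#
        +-closed       : ∀ i j → ∃ λ k → elem k ≈ elem i + elem j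

    infix 4 _∈_ _∈?_

    _∈_ : ∀ {s} → Carrier → AdditiveSubgroup s → Set ℓ
    x ∈ S = ∃ λ i → AdditiveSubgroup.elem S i ≈ x

    _∈?_ : ∀ {s} x (S : AdditiveSubgroup s) → Dec (x ∈ S)
    x ∈? S = Fin.any? (λ i → AdditiveSubgroup.elem S i ≟ x)

    module Closure {s} (S : AdditiveSubgroup s) where
      open AdditiveSubgroup S

      ∈-resp : ∀ {x y} → x ≈ y → x ∈ S → y ∈ S
      ∈-resp x≈y (i , eᵢ≈x) = i , trans eᵢ≈x x≈y

      +-∈ : ∀ {x y} → x ∈ S → y ∈ S → x + y ∈ S
      +-∈ (i , eᵢ≈x) (j , eⱼ≈y) = ∈-resp (+-cong eᵢ≈x eⱼ≈y) (+-closed i j)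

      ·-∈ : ∀ {x} → x ∈ S → ∀ n → n · x ∈ S
      ·-∈ x∈S zero    = 0∈
      ·-∈ x∈S (suc n) = +-∈ x∈S (·-∈ x∈S n)

      -‿∈ : ∀ {x} → x ∈ S → - x ∈ S
      -‿∈ {x} x∈S = ∈-resp (sym (-x≈[p-1]·x x)) (·-∈ x∈S (p ℕ.∸ 1))

      ·-cancel-∈ : ∀ {δ x} → 0 < δ → δ < p → δ · x ∈ S → x ∈ S
      ·-cancel-∈ {δ} {x} 0<δ δ<p δx∈S with coprime-Bézout (prime⇒coprime p-prime {{ℕ.>-nonZero 0<δ}} δ<p)
      ... | Bézout.+- i j 1+jδ≡ip = ∈-resp (sym (+-inverseˡ-unique x _ (begin
        x + j · (δ · x)          ≈⟨ +-congˡ (×-assocˡ x j δ) ⟩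
        x + (j ℕ.* δ) · x        ≡⟨⟩
        suc (j ℕ.* δ) · x        ≈⟨ ×-congˡ 1+jδ≡ip ⟩
        (i ℕ.* p) · x            ≈⟨ [q*p]·x≈0 i x ⟩
        0#                       ∎))) (-‿∈ (·-∈ δx∈S j))
      ... | Bézout.-+ i j 1+ip≡jδ = ∈-resp (begin
        j · (δ · x)              ≈⟨ ×-assocˡ x j δ ⟩
        (j ℕ.* δ) · x            ≈⟨ ×-congˡ 1+ip≡jδ ⟨
        x + (i ℕ.* p) · x        ≈⟨ +-congˡ ([q*p]·x≈0 i x) ⟩
        x + 0#                   ≈⟨ +-identityʳ x ⟩
        x                        ∎) (·-∈ δx∈S j)

    module Extension {s} (S : AdditiveSubgroup s) (x : Carrier) (x∉S : ¬ x ∈ S) where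
      open AdditiveSubgroup S
      open Closure S

      ψ : Fin p → Fin s → Carrier
      ψ a i = toℕ a · x + elem i

      offset≡0 : ∀ {δ i i′} → δ < p → elem i ≈ δ · x + elem i′ → δ ≡ 0 × i ≡ i′
      offset≡0 {zero}  _ eᵢ≈0·x+eᵢ′ = ≡.refl , elem-injective (trans eᵢ≈0·x+eᵢ′ (+-identityˡ _))
      offset≡0 {δ@(suc _)} {i} {i′} δ<p eᵢ≈δx+eᵢ′ = contradiction (·-cancel-∈ ℕ.z<s δ<p δx∈S) x∉S
        where
        δx∈S : δ · x ∈ S
        δx∈S = ∈-resp (begin
          elem i + - elem i′                ≈⟨ +-congʳ eᵢ≈δx+eᵢ′ ⟩
          δ · x + elem i′ + - elem i′       ≈⟨ +-assoc _ _ _ ⟩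
          δ · x + (elem i′ + - elem i′)     ≈⟨ +-congˡ (-‿inverseʳ _) ⟩
          δ · x + 0#                        ≈⟨ +-identityʳ _ ⟩
          δ · x                             ∎) (+-∈ (i , refl) (-‿∈ (i′ , refl)))

      ψ-injective≤ : ∀ {a a′ i i′} → toℕ a ≤ toℕ a′ → ψ a i ≈ ψ a′ i′ → a ≡ a′ × i ≡ i′
      ψ-injective≤ {a} {a′} {i} {i′} a≤a′ ψ≈ψ′ = conclude (offset≡0 δ<p eᵢ≈δx+eᵢ′)
        where
        δ : ℕ
        δ = toℕ a′ ℕ.∸ toℕ a
        δ<p : δ < p
        δ<p = ℕ.≤-<-trans (ℕ.m∸n≤m (toℕ a′) (toℕ a)) (Fin.toℕ<n a′)
        eᵢ≈δx+eᵢ′ : elem i ≈ δ · x + elem i′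
        eᵢ≈δx+eᵢ′ = +-cancelˡ (toℕ a · x) _ _ (begin
          toℕ a · x + elem i                 ≈⟨ ψ≈ψ′ ⟩
          toℕ a′ · x + elem i′               ≈⟨ +-congʳ (×-congˡ (ℕ.m+[n∸m]≡n a≤a′)) ⟨
          (toℕ a ℕ.+ δ) · x + elem i′        ≈⟨ +-congʳ (×-homo-+ x (toℕ a) δ) ⟩
          toℕ a · x + δ · x + elem i′        ≈⟨ +-assoc _ _ _ ⟩
          toℕ a · x + (δ · x + elem i′)      ∎)
        conclude : δ ≡ 0 × i ≡ i′ → a ≡ a′ × i ≡ i′
        conclude (δ≡0 , i≡i′) = Fin.toℕ-injective (ℕ.≤-antisym a≤a′ (ℕ.m∸n≡0⇒m≤n δ≡0)) , i≡i′

      ψ-injective : ∀ {a a′ i i′} → ψ a i ≈ ψ a′ i′ → a ≡ a′ × i ≡ i′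
      ψ-injective {a} {a′} ψ≈ψ′ with ℕ.≤-total (toℕ a) (toℕ a′)
      ... | inj₁ a≤a′ = ψ-injective≤ a≤a′ ψ≈ψ′
      ... | inj₂ a′≤a = map ≡.sym ≡.sym (ψ-injective≤ a′≤a (sym ψ≈ψ′))

      elem′ : Fin (p ℕ.* s) → Carrier
      elem′ j = uncurry ψ (Fin.remQuot {p} s j)

      elem′-combine : ∀ a i → elem′ (Fin.combine a i) ≡ ψ a i
      elem′-combine a i = ≡.cong (uncurry ψ) (Fin.remQuot-combine a i)

      elem′-injective : ∀ {j j′} → elem′ j ≈ elem′ j′ → j ≡ j′
      elem′-injective {j} {j′} eⱼ≈eⱼ′ with a≡a′ , i≡i′ ← ψ-injective eⱼ≈eⱼ′ =
        ≡.trans (≡.sym (Fin.combine-remQuot {p} s j))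
                (≡.trans (≡.cong₂ Fin.combine a≡a′ i≡i′) (Fin.combine-remQuot {p} s j′))

      0∈′ : ∃ λ j → elem′ j ≈ 0#
      0∈′ = Fin.combine a₀ (proj₁ 0∈) , (begin
        elem′ (Fin.combine a₀ (proj₁ 0∈))   ≡⟨ elem′-combine a₀ (proj₁ 0∈) ⟩
        toℕ a₀ · x + elem (proj₁ 0∈)        ≈⟨ +-cong (×-congˡ (Fin.toℕ-fromℕ< (ℕ.>-nonZero⁻¹ p))) (proj₂ 0∈) ⟩
        0# + 0#                             ≈⟨ +-identityʳ 0# ⟩
        0#                                  ∎)
        where
        a₀ : Fin p
        a₀ = Fin.fromℕ< (ℕ.>-nonZero⁻¹ p)

      +-closed′ : ∀ j j′ → ∃ λ k → elem′ k ≈ elem′ j + elem′ j′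
      +-closed′ j j′ = Fin.combine a″ (proj₁ (+-closed i i′)) , (begin
        elem′ (Fin.combine a″ (proj₁ (+-closed i i′)))  ≡⟨ elem′-combine a″ _ ⟩
        toℕ a″ · x + elem (proj₁ (+-closed i i′))      ≈⟨ +-cong (×-congˡ (Fin.toℕ-fromℕ< (m%n<n (a ℕ.+ a′) p)))
                                                                   (proj₂ (+-closed i i′)) ⟩
        ((a ℕ.+ a′) % p) · x + (elem i + elem i′)       ≈⟨ +-congʳ (·-mod (a ℕ.+ a′) x) ⟩
        (a ℕ.+ a′) · x + (elem i + elem i′)             ≈⟨ +-congʳ (×-homo-+ x a a′) ⟩
        a · x + a′ · x + (elem i + elem i′)             ≈⟨ interchange _ _ _ _ ⟩
        a · x + elem i + (a′ · x + elem i′)             ∎)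
        where
        i i′ : Fin s
        i  = proj₂ (Fin.remQuot {p} s j)
        i′ = proj₂ (Fin.remQuot {p} s j′)
        a a′ : ℕ
        a  = toℕ (proj₁ (Fin.remQuot {p} s j))
        a′ = toℕ (proj₁ (Fin.remQuot {p} s j′))
        a″ : Fin p
        a″ = Fin.fromℕ< (m%n<n (a ℕ.+ a′) p)

      extension : AdditiveSubgroup (p ℕ.* s)
      extension = record
        { elem           = elem′
        ; elem-injective = elem′-injective
        ; 0∈             = 0∈′
        ; +-closed       = +-closed′
        }

    open Extension using (extension)

    zeroSubgroup : AdditiveSubgroup 1
    zeroSubgroup = record
      { elem           = λ _ → 0#
      ; elem-injective = λ { {Fin.zero} {Fin.zero} _ → ≡.refl }
      ; 0∈             = Fin.zero , refl
      ; +-closed       = λ _ _ → Fin.zero , sym (+-identityʳ 0#)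
      }

    size≤card : ∀ {s} → AdditiveSubgroup s → s ≤ suc m
    size≤card S = Fin.injective⇒≤ (elem-injective ∘ from-injective)
      where open AdditiveSubgroup S

    card≤size : ∀ {s} (S : AdditiveSubgroup s) → (∀ j → to j ∈ S) → suc m ≤ s
    card≤size S covered = Fin.injective⇒≤ {f = proj₁ ∘ covered} λ {j} {j′} eq →
      to-injective (trans (sym (proj₂ (covered j))) (trans (reflexive (≡.cong elem eq)) (proj₂ (covered j′))))
      where open AdditiveSubgroup S

    -- Each extension strictly increases p ^ k ≤ suc m, so the bound makes fuel sufficient.
    grow : ∀ fuel k → AdditiveSubgroup (p ℕ.^ k) → suc (suc m) ≤ p ℕ.^ k ℕ.+ fuel → ∃ λ k → p ℕ.^ k ≡ suc m
    grow fuel k S bound with Fin.all? (λ j → to j ∈? S)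
    ... | yes covered = k , ℕ.≤-antisym (size≤card S) (card≤size S covered)
    grow zero       k S bound | no _ =
      contradiction (ℕ.≤-trans (ℕ.≤-trans bound (ℕ.≤-reflexive (ℕ.+-identityʳ _))) (size≤card S)) ℕ.1+n≰n
    grow (suc fuel) k S bound | no uncovered
      with j , tⱼ∉S ← Fin.¬∀⟶∃¬ (suc m) _ (λ j → to j ∈? S) uncovered
      = grow fuel (suc k) (extension S (to j) tⱼ∉S)
          (ℕ.≤-trans bound (ℕ.≤-trans (ℕ.≤-reflexive (ℕ.+-suc _ fuel))
                                      (ℕ.+-monoˡ-≤ fuel (ℕ.^-monoʳ-< p (prime>1 p-prime) (ℕ.n<1+n k)))))

    card≡p^k : ∃ λ k → p ℕ.^ k ≡ suc m
    card≡p^k = grow (suc m) 0 zeroSubgroup ℕ.≤-refl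

  card-primePower : IsPrimePower (suc m)
  card-primePower with p , p-prime , p·1≈0 ← characteristic
                  with k , pᵏ≡1+m ← card≡p^k p-prime p·1≈0 = p , k , p-prime , ≡.sym pᵏ≡1+m

  ∃-unit∉μ : ∀ n → .{{NonZero n}} → n < m → ∃ λ i → ¬ μ n (unit i)
  ∃-unit∉μ n n<m = Fin.¬∀⟶∃¬ m _ (λ i → (proj₁ (unit i) ^ n) ≟ 1#)
    (λ all∈μⁿ → ℕ.<⇒≱ n<m (roots-of-unity-bound n (proj₁ ∘ unit) unit-injective all∈μⁿ))

  μ-nontrivial : ∀ {a b} → 1 < a → 1 < b → a ℕ.* b ≡ m → Nontrivial (μ a)
  μ-nontrivial {a} {b} 1<a 1<b ab≡m = outside-μᵇ (∃-unit∉μ b {{b≢0}} b<m)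
    where
    b≢0 : NonZero b
    b≢0 = ℕ.>-nonZero (ℕ.<-trans ℕ.z<s 1<b)
    b<m : b < m
    b<m = ≡.subst (b <_) (≡.trans (ℕ.*-comm b a) ab≡m) (ℕ.m<m*n b a {{b≢0}} 1<a)
    outside-μᵇ : ∃ (λ i → ¬ μ b (unit i)) → Nontrivial (μ a)
    outside-μᵇ (i , gᵇ≉1) = unit i ^ᵘ b , gᵇ∈μᵃ , gᵇ≉1
      where
      gᵇ∈μᵃ : μ a (unit i ^ᵘ b)
      gᵇ∈μᵃ = trans (^-assocʳ (proj₁ (unit i)) b a)
                    (trans (^-congʳ _ (≡.trans (ℕ.*-comm b a) ab≡m)) (fermat (unit i)))

  μ-Factorisation : ℕ → ℕ → Unit → Set (c ⊔ ℓ)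
  μ-Factorisation a b w = Σ Unit λ u → Σ Unit λ v → μ a u × μ b v × proj₁ w ≈ proj₁ u * proj₁ v

  -- With a = 1 + a′ and 1 + j b = i a: w = w ^ (a′ j b) · w ^ (i a), as a′ j b + i a = 1 + j m.
  μ-factorisation : ∀ {a b i j} → a ℕ.* b ≡ m → 1 ℕ.+ j ℕ.* b ≡ i ℕ.* a → ∀ w → μ-Factorisation a b w
  μ-factorisation {zero} {i = i} _ 1+jb≡i*0 _ = contradiction (≡.trans 1+jb≡i*0 (ℕ.*-zeroʳ i)) λ ()
  μ-factorisation {a@(suc a′)} {b} {i} {j} ab≡m 1+jb≡ia w@(x , _) = w ^ᵘ e₁ , w ^ᵘ e₂ , uᵃ≈1 , vᵇ≈1 , (begin
    x                       ≈⟨ *-identityʳ x ⟨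
    x * 1#                  ≈⟨ *-congˡ (x^a≈1⇒x^[n*a]≈1 j (fermat w)) ⟨
    x * x ^ (j ℕ.* m)       ≡⟨⟩
    x ^ suc (j ℕ.* m)       ≈⟨ ^-congʳ x e₁+e₂≡1+jm ⟨
    x ^ (e₁ ℕ.+ e₂)         ≈⟨ ^-homo-* x e₁ e₂ ⟩
    x ^ e₁ * x ^ e₂         ∎)
    where
    e₁ e₂ : ℕ
    e₁ = a′ ℕ.* (j ℕ.* b)
    e₂ = i ℕ.* a
    uᵃ≈1 : μ a (w ^ᵘ e₁)
    uᵃ≈1 = trans (^-assocʳ x e₁ a) (trans (^-congʳ x (≡.trans (regroup a′ j b) (≡.cong (a′ ℕ.* j ℕ.*_) ab≡m)))
             (x^a≈1⇒x^[n*a]≈1 (a′ ℕ.* j) (fermat w)))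
      where
      regroup : ∀ a′ j b → a′ ℕ.* (j ℕ.* b) ℕ.* (1 ℕ.+ a′) ≡ a′ ℕ.* j ℕ.* ((1 ℕ.+ a′) ℕ.* b)
      regroup = solve-∀
    vᵇ≈1 : μ b (w ^ᵘ e₂)
    vᵇ≈1 = trans (^-assocʳ x e₂ b) (trans (^-congʳ x (≡.trans (ℕ.*-assoc i a b) (≡.cong (i ℕ.*_) ab≡m)))
             (x^a≈1⇒x^[n*a]≈1 i (fermat w)))
    e₁+e₂≡1+jm : e₁ ℕ.+ e₂ ≡ suc (j ℕ.* m)
    e₁+e₂≡1+jm = ≡.trans (≡.cong (e₁ ℕ.+_) (≡.sym 1+jb≡ia))
                   (≡.trans (regroup a′ j b) (≡.cong (λ n → suc (j ℕ.* n)) ab≡m))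
      where
      regroup : ∀ a′ j b → a′ ℕ.* (j ℕ.* b) ℕ.+ (1 ℕ.+ j ℕ.* b) ≡ 1 ℕ.+ j ℕ.* ((1 ℕ.+ a′) ℕ.* b)
      regroup = solve-∀

  coprime⇒μ-factorisation : ∀ {a b} → Coprime a b → a ℕ.* b ≡ m → ∀ w → μ-Factorisation a b w
  coprime⇒μ-factorisation {a} {b} coprime ab≡m w with coprime-Bézout coprime
  ... | Bézout.+- i j 1+jb≡ia = μ-factorisation {a} {b} {i} {j} ab≡m 1+jb≡ia w
  ... | Bézout.-+ i j 1+ia≡jb
    with v , u , vᵇ≈1 , uᵃ≈1 , w≈vu ← μ-factorisation {b} {a} {j} {i} (≡.trans (ℕ.*-comm b a) ab≡m) 1+ia≡jb w =
    u , v , uᵃ≈1 , vᵇ≈1 , trans w≈vu (*-comm _ _)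

  coprimeFactorisation⇒decomposable : CoprimeFactorisation m → ¬ Indecomposable
  coprimeFactorisation⇒decomposable (a , b , 1<a , 1<b , coprime , ab≡m) indecomposable =
    indecomposable (μ a , μ b , μ-isSubgroup a , μ-isSubgroup b ,
      μ-nontrivial 1<a 1<b ab≡m , μ-nontrivial 1<b 1<a (≡.trans (ℕ.*-comm b a) ab≡m) ,
      (λ _ uᵃ≈1 uᵇ≈1 → coprime-exponents⇒≈1 coprime uᵃ≈1 uᵇ≈1) , coprime⇒μ-factorisation coprime ab≡m)

  indecomposable⇔primePower : Indecomposable ⇔ IsPrimePower m
  indecomposable⇔primePower = mk⇔ primePower indecomposable
    where
    primePower : Indecomposable → IsPrimePower m
    primePower indecomposable with primePower⊎coprimeFactorisation m {{Fin.nonZeroIndex (indexOf (1# , 1≉0))}}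
    ... | inj₁ m-primePower  = m-primePower
    ... | inj₂ factorisation = contradiction indecomposable (coprimeFactorisation⇒decomposable factorisation)
    indecomposable : IsPrimePower m → Indecomposable
    indecomposable (r , e , r-prime , m≡rᵉ) =
      primePower-exponent⇒indecomposable _≟_ {e = e} r-prime (λ u → trans (^-congʳ _ (≡.sym m≡rᵉ)) (fermat u))

  indecomposable⇔listed : Indecomposable ⇔ ListedOrder (suc m)
  indecomposable⇔listed = mk⇔
    (primePower∧primePower⇒listed card-primePower ∘ Equivalence.to indecomposable⇔primePower)
    (Equivalence.from indecomposable⇔primePower ∘ listed⇒primePower)

card-unique : ∀ {c ℓ} (F : Field c ℓ) {m n} → HasCard F m → HasCard F n → m ≡ n
card-unique F m-enum n-enum = ↔⇒≡ (Composition.inverse m-enum (Symmetry.inverse n-enum))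

-- Opened only here so that _+_ above always means the field addition.
open import Data.Nat.Base using (_+_)

IsoToListedField : ∀ {c ℓ} → Field c ℓ → Set (c ⊔ ℓ)
IsoToListedField F = IsoToFF F 2 ⊎ IsoToFF F 9 ⊎ Σ ℕ (λ p → FermatPrime p × IsoToFF F p)
                   ⊎ Σ ℕ (λ q → MersennePrime q × IsoToFF F (q + 1))

listed⇔isoToListed : ∀ {c ℓ} (F : Field c ℓ) {n} → HasCard F n → ListedOrder n ⇔ IsoToListedField F
listed⇔isoToListed F {n} enum = mk⇔ iso listed
  where
  iso : ListedOrder n → IsoToListedField F
  iso (inj₁ n≡2)                                    = inj₁ (≡.subst (HasCard F) n≡2 enum)
  iso (inj₂ (inj₁ n≡9))                             = inj₂ (inj₁ (≡.subst (HasCard F) n≡9 enum))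
  iso (inj₂ (inj₂ (inj₁ n-fermat)))                 = inj₂ (inj₂ (inj₁ (n , n-fermat , enum)))
  iso (inj₂ (inj₂ (inj₂ (q , q-mersenne , n≡q+1)))) =
    inj₂ (inj₂ (inj₂ (q , q-mersenne , ≡.subst (HasCard F) n≡q+1 enum)))
  listed : IsoToListedField F → ListedOrder n
  listed (inj₁ enum₂)                                = inj₁ (card-unique F enum enum₂)
  listed (inj₂ (inj₁ enum₉))                         = inj₂ (inj₁ (card-unique F enum enum₉))
  listed (inj₂ (inj₂ (inj₁ (p , p-fermat , enumₚ)))) =
    inj₂ (inj₂ (inj₁ (≡.subst FermatPrime (≡.sym (card-unique F enum enumₚ)) p-fermat)))
  listed (inj₂ (inj₂ (inj₂ (q , q-mersenne , enum₍q+1₎)))) =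
    inj₂ (inj₂ (inj₂ (q , q-mersenne , card-unique F enum enum₍q+1₎)))

mainTheorem4 : ∀ {c ℓ} (F : FiniteField c ℓ) →
  Units.Indecomposable (FiniteField.field′ F) ⇔
    ( IsoToFF (FiniteField.field′ F) 2
    ⊎ IsoToFF (FiniteField.field′ F) 9
    ⊎ Σ ℕ (λ p → FermatPrime p × IsoToFF (FiniteField.field′ F) p)
    ⊎ Σ ℕ (λ q → MersennePrime q × IsoToFF (FiniteField.field′ F) (q + 1)) )
mainTheorem4 F = listed⇔isoToListed field′ enum′ ⇔-∘ FiniteFieldProperties.indecomposable⇔listed field′ enum′
  where
  open FiniteField F using (field′; card; enum; 0#)
  enum′ : HasCard field′ (suc (ℕ.pred card))
  enum′ = ≡.subst (HasCard field′) (≡.sym (ℕ.suc-pred card {{Fin.nonZeroIndex (Inverse.from enum 0#)}})) enum
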